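{- Let $n,q,\ell\in\mathbb{N}$ and let $\mathcal{A}$ be a $q$-query randomized local search algorithm. There is a monotone $f:\{0,1\}^n\to\{0,1\}$ with $C(f)=1$ and an input $x^\star\in\{0,1\}^n$ on which $\mathcal{A}$ successfully returns a certificate of size $\ell$ for $f$'s value on $x^\star$ with probability at most $(\ell+q-1)/n$.
   Context: A set $S\subseteq[n]$ is a certificate for $f$'s value on $x$ if $f(y)=f(x)$ for all $y$ agreeing with $x$ on $S$; $C(f)$ is the maximum over $x$ of the minimum size of such a certificate. $f$ is monotone if $x\le y$ coordinatewise implies $f(x)\le f(y)$. A local search algorithm (for certifying $f$'s value on $x^\star$) is a query algorithm whose first query is $x^\star$ and each of whose subsequent queries is at Hamming distance $1$ from some previously queried input. A $q$-query algorithm makes at most $q$ queries.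
   Formalization: The randomized algorithm $\mathcal{A}$ ranges only over distributions with rational probabilities on deterministic $q$-query local search algorithms. -}

module Defs where

open import Data.Nat using (ℕ; zero; suc; _+_; _≤_)
open import Data.Bool using (Bool; true; false; _≟_)
import Data.Bool as B
open import Data.Vec using (Vec; []; _∷_; lookup)
open import Data.Fin using (Fin)
open import Data.Fin.Subset using (Subset; _∈_; ∣_∣)
open import Data.Fin.Subset.Properties using (_∈?_)
open import Data.Fin.Properties using (all?)
open import Data.List using (List; []; _∷_; length; filter)
open import Data.List.Relation.Unary.Any using (Any)
open import Data.Product using (Σ; ∃; _×_; _,_)
open import Data.Unit using (⊤)
open import Relation.Binary.PropositionalEquality using (_≡_)
open import Relation.Nullary using (Dec; yes; no; ¬_)
open import Relation.Nullary.Decidable using (_→-dec_; _×-dec_; map′)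
import Data.Nat as N

Input : ℕ → Set
Input n = Vec Bool n

BoolFun : ℕ → Set
BoolFun n = Input n → Bool

hamming : ∀ {n} → Input n → Input n → ℕ
hamming [] [] = 0
hamming (a ∷ x) (b ∷ y) with a ≟ b
... | yes _ = hamming x y
... | no  _ = suc (hamming x y)

Monotone : ∀ {n} → BoolFun n → Set
Monotone {n} f = ∀ (x y : Input n) → (∀ i → lookup x i B.≤ lookup y i) → f x B.≤ f y

AgreeOn : ∀ {n} → Subset n → Input n → Input n → Set
AgreeOn {n} S y x = ∀ (i : Fin n) → i ∈ S → lookup y i ≡ lookup x i

IsCertificate : ∀ {n} → BoolFun n → Input n → Subset n → Set
IsCertificate {n} f x S = ∀ (y : Input n) → AgreeOn S y x → f y ≡ f x

-- C(f) = c : max over x of the minimum certificate size of x equals c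
-- (every x has a certificate of size ≤ c, and some x has no certificate of size < c)
CertComplexityIs : ∀ {n} → BoolFun n → ℕ → Set
CertComplexityIs {n} f c =
  (∀ (x : Input n) → Σ (Subset n) λ S → IsCertificate f x S × ∣ S ∣ ≤ c)
  × Σ (Input n) λ x → ∀ (S : Subset n) → IsCertificate f x S → c ≤ ∣ S ∣

-- Deterministic adaptive query algorithm (decision tree) with at most k queries,
-- which at the end outputs a set S ⊆ [n].
data Tree (n : ℕ) : ℕ → Set where
  leaf : ∀ {k} → Subset n → Tree n k
  node : ∀ {k} → Input n → (Bool → Tree n k) → Tree n (suc k)

LocalFrom : ∀ {n k} → List (Input n) → Tree n k → Set
LocalFrom hist (leaf S) = ⊤
LocalFrom hist (node y t) = Any (λ z → hamming y z ≡ 1) hist × (∀ b → LocalFrom (y ∷ hist) (t b))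

IsLocalSearch : ∀ {n k} → Input n → Tree n k → Set
IsLocalSearch x⋆ (leaf S) = ⊤
IsLocalSearch x⋆ (node y t) = y ≡ x⋆ × (∀ b → LocalFrom (y ∷ []) (t b))

run : ∀ {n k} → BoolFun n → Tree n k → Subset n
run f (leaf S) = S
run f (node y t) = run f (t (f y))

record LocalAlg (n q : ℕ) : Set where
  field
    tree  : Input n → Tree n q
    local : ∀ x⋆ → IsLocalSearch x⋆ (tree x⋆)
open LocalAlg public

Success : ∀ {n q} → ℕ → BoolFun n → Input n → LocalAlg n q → Set
Success ℓ f x⋆ A = IsCertificate f x⋆ (run f (tree A x⋆)) × ∣ run f (tree A x⋆) ∣ ≡ ℓ

∀Vec? : ∀ n {P : Vec Bool n → Set} → (∀ y → Dec (P y)) → Dec (∀ y → P y)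
∀Vec? zero P? with P? []
... | yes p = yes λ { [] → p }
... | no ¬p = no λ h → ¬p (h [])
∀Vec? (suc n) {P} P? with ∀Vec? n (λ y → P? (true ∷ y)) | ∀Vec? n (λ y → P? (false ∷ y))
... | yes pt | yes pf = yes λ { (true ∷ y) → pt y ; (false ∷ y) → pf y }
... | no ¬p | _ = no λ h → ¬p (λ y → h (true ∷ y))
... | yes _ | no ¬p = no λ h → ¬p (λ y → h (false ∷ y))

isCertificate? : ∀ {n} f (x : Input n) S → Dec (IsCertificate f x S)
isCertificate? {n} f x S =
  ∀Vec? n (λ y → all? (λ i → (i ∈? S) →-dec (lookup y i ≟ lookup x i)) →-dec (f y ≟ f x))

success? : ∀ {n q} ℓ f x⋆ (A : LocalAlg n q) → Dec (Success ℓ f x⋆ A)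
success? ℓ f x⋆ A = isCertificate? f x⋆ (run f (tree A x⋆)) ×-dec (∣ run f (tree A x⋆) ∣ N.≟ ℓ)

-- A randomized q-query local search algorithm with rational probabilities:
-- the uniform distribution over a finite (multi)list of deterministic ones.
RandLocalAlg : ℕ → ℕ → Set
RandLocalAlg n q = List (LocalAlg n q)

-- number of members of the multiset that succeed (success probability = this / length)
successCount : ∀ {n q} → ℕ → BoolFun n → Input n → RandLocalAlg n q → ℕ
successCount ℓ f x⋆ 𝒜 = length (filter (success? ℓ f x⋆) 𝒜)

{-# OPTIONS --safe #-}
-- Use the dictators x ↦ xᵢ and the all-zero input. A local search started at 0 sees only
-- answers 0 until it queries an input containing i, and since every query is at Hamming
-- distance 1 from an earlier one, the queries along this all-zero path together contain at
-- most q − 1 coordinates. For every i outside them the algorithm behaves as against the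
-- constant 0 and returns a fixed set S₀, which certifies xᵢ only if i ∈ S₀ and has size ℓ only
-- if ∣S₀∣ = ℓ. So each deterministic algorithm succeeds for at most ℓ + q − 1 dictators, and
-- averaging over i gives a dictator on which the randomized algorithm succeeds with
-- probability at most (ℓ + q − 1)/n.
module Submission where

open import Defs
open import Data.Nat using (ℕ; zero; suc; _+_; _*_; _∸_; _≤_; _≥_; z≤n; s≤s)
open import Data.Nat.Properties
open import Data.Bool using (false; not; _xor_; if_then_else_)
import Data.Bool as B
open import Data.Bool.Properties using (not-¬)
open import Data.Vec using (lookup; zipWith; []; _∷_; here)
open import Data.Vec.Properties using (lookup-zipWith; lookup-map; []=⇒lookup; lookup⇒[]=)
open import Data.Fin using (Fin; zero; suc)
open import Data.Fin.Subset
  using (Subset; inside; outside; ⊥; _∪_; ∁; ⁅_⁆; ⋃; ∣_∣; _∈_; _∉_; _⊆_)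
open import Data.Fin.Subset.Properties
  using ( _∈?_; drop-∷-⊆; ∣p∣≤∣x∷p∣; ∣⊥∣≡0; ∪-assoc; ∪-identityʳ; p⊆p∪q; q⊆p∪q
        ; ⊆-refl; ⊆-trans; x∈⁅x⁆; ∣⁅x⁆∣≡1; x∈p⇒∣p-x∣<∣p∣)
open import Data.List using (List; []; _∷_; length; filter)
open import Data.List.Relation.Unary.All using (All; []; _∷_; lookupAny)
import Data.List.Relation.Unary.All as All
open import Data.Product using (Σ; ∃; _×_; _,_; proj₁)
open import Data.Sum using (_⊎_; inj₁; inj₂; [_,_])
open import Function using (_∘_; id)
open import Relation.Binary.PropositionalEquality using (_≡_; refl; sym; trans; cong; subst; module ≡-Reasoning)
open import Relation.Nullary using (Dec; yes; no; contradiction)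
open import Algebra.Properties.CommutativeMonoid.Sum +-0-commutativeMonoid
  using (sum-syntax; ∑-distrib-+; sum-replicate-zero)

∉⇒lookup≡outside : ∀ {n} {p : Subset n} {i} → i ∉ p → lookup p i ≡ outside
∉⇒lookup≡outside {p = p} {i} i∉p with lookup p i in eq
... | outside = refl
... | inside  = contradiction (lookup⇒[]= i p eq) i∉p

∉⋃⇒All∉ : ∀ {n} {i : Fin n} (ps : List (Subset n)) → i ∉ ⋃ ps → All (i ∉_) ps
∉⋃⇒All∉ []       _    = []
∉⋃⇒All∉ (p ∷ ps) i∉⋃ =
  i∉⋃ ∘ p⊆p∪q (⋃ ps) ∷ ∉⋃⇒All∉ ps (i∉⋃ ∘ q⊆p∪q p (⋃ ps))

∣p∪q∣≤∣p∣+∣q∣ : ∀ {n} (p q : Subset n) → ∣ p ∪ q ∣ ≤ ∣ p ∣ + ∣ q ∣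
∣p∪q∣≤∣p∣+∣q∣ []            []            = z≤n
∣p∪q∣≤∣p∣+∣q∣ (inside  ∷ p) (s       ∷ q) =
  s≤s (≤-trans (∣p∪q∣≤∣p∣+∣q∣ p q) (+-monoʳ-≤ ∣ p ∣ (∣p∣≤∣x∷p∣ s q)))
∣p∪q∣≤∣p∣+∣q∣ (outside ∷ p) (inside  ∷ q) =
  ≤-trans (s≤s (∣p∪q∣≤∣p∣+∣q∣ p q)) (≤-reflexive (sym (+-suc ∣ p ∣ ∣ q ∣)))
∣p∪q∣≤∣p∣+∣q∣ (outside ∷ p) (outside ∷ q) = ∣p∪q∣≤∣p∣+∣q∣ p q

∣p∪y∣≤∣p∣+hamming : ∀ {n} (p y z : Subset n) → z ⊆ p → ∣ p ∪ y ∣ ≤ ∣ p ∣ + hamming y z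
∣p∪y∣≤∣p∣+hamming []            []            []            _   = z≤n
∣p∪y∣≤∣p∣+hamming (inside  ∷ p) (a       ∷ y) (b       ∷ z) z⊆p with a B.≟ b
... | yes _ = s≤s (∣p∪y∣≤∣p∣+hamming p y z (drop-∷-⊆ z⊆p))
... | no  _ = s≤s (≤-trans (∣p∪y∣≤∣p∣+hamming p y z (drop-∷-⊆ z⊆p)) (+-monoʳ-≤ ∣ p ∣ (n≤1+n _)))
∣p∪y∣≤∣p∣+hamming (outside ∷ p) (outside ∷ y) (outside ∷ z) z⊆p =
  ∣p∪y∣≤∣p∣+hamming p y z (drop-∷-⊆ z⊆p)
∣p∪y∣≤∣p∣+hamming (outside ∷ p) (inside  ∷ y) (outside ∷ z) z⊆p =
  ≤-trans (s≤s (∣p∪y∣≤∣p∣+hamming p y z (drop-∷-⊆ z⊆p))) (≤-reflexive (sym (+-suc _ _)))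
∣p∪y∣≤∣p∣+hamming (outside ∷ p) (_       ∷ y) (inside  ∷ z) z⊆p = contradiction (z⊆p here) λ ()

falsePathQueries : ∀ {n k} → Tree n k → List (Input n)
falsePathQueries (leaf _)   = []
falsePathQueries (node y t) = y ∷ falsePathQueries (t false)

run-falsePath : ∀ {n k} (f : BoolFun n) (t : Tree n k) →
  All (λ y → f y ≡ false) (falsePathQueries t) → run f t ≡ run (λ _ → false) t
run-falsePath f (leaf _)   _ = refl
run-falsePath f (node y t) (fy≡false ∷ rest) rewrite fy≡false = run-falsePath f (t false) rest

∣∪⋃falsePathQueries∣≤ : ∀ {n k} {hist : List (Input n)} (H : Subset n) (t : Tree n k) →
  LocalFrom hist t → All (_⊆ H) hist → ∣ H ∪ ⋃ (falsePathQueries t) ∣ ≤ ∣ H ∣ + k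
∣∪⋃falsePathQueries∣≤ {k = k} H (leaf _) _ _ =
  ≤-trans (≤-reflexive (cong ∣_∣ (∪-identityʳ H))) (m≤m+n ∣ H ∣ k)
∣∪⋃falsePathQueries∣≤ {k = suc k} H (node y t) (near , local) hist⊆H = begin
  ∣ H ∪ (y ∪ U) ∣   ≡⟨ cong ∣_∣ (sym (∪-assoc H y U)) ⟩
  ∣ (H ∪ y) ∪ U ∣   ≤⟨ ∣∪⋃falsePathQueries∣≤ (H ∪ y) (t false) (local false) hist′⊆H∪y ⟩
  ∣ H ∪ y ∣ + k     ≤⟨ +-monoˡ-≤ k ∣H∪y∣≤∣H∣+1 ⟩
  ∣ H ∣ + 1 + k     ≡⟨ +-assoc ∣ H ∣ 1 k ⟩
  ∣ H ∣ + suc k     ∎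
  where
  open ≤-Reasoning
  U = ⋃ (falsePathQueries (t false))
  ⊆H⇒⊆H∪y : ∀ {z} → z ⊆ H → z ⊆ H ∪ y
  ⊆H⇒⊆H∪y z⊆H = ⊆-trans z⊆H (p⊆p∪q y)
  hist′⊆H∪y = q⊆p∪q H y ∷ All.map ⊆H⇒⊆H∪y hist⊆H
  ∣H∪y∣≤∣H∣+1 : ∣ H ∪ y ∣ ≤ ∣ H ∣ + 1
  ∣H∪y∣≤∣H∣+1 with lookupAny hist⊆H near
  ... | z⊆H , y∼z = subst (λ d → ∣ H ∪ y ∣ ≤ ∣ H ∣ + d) y∼z (∣p∪y∣≤∣p∣+hamming H y _ z⊆H)

∣⋃falsePathQueries∣≤ : ∀ {n q} {x⋆ : Input n} (t : Tree n q) →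
  IsLocalSearch x⋆ t → ∣ ⋃ (falsePathQueries t) ∣ ≤ ∣ x⋆ ∣ + (q ∸ 1)
∣⋃falsePathQueries∣≤ {n} (leaf _) _ = ≤-trans (≤-reflexive (∣⊥∣≡0 n)) z≤n
∣⋃falsePathQueries∣≤ (node y t) (refl , local) =
  ∣∪⋃falsePathQueries∣≤ y (t false) (local false) (⊆-refl ∷ [])

dictator : ∀ {n} → Fin n → BoolFun n
dictator i x = lookup x i

dictator-monotone : ∀ {n} (i : Fin n) → Monotone (dictator i)
dictator-monotone i x y x≤y = x≤y i

-- Flipping x outside S gives an input agreeing with x on S but, if i ∉ S, not at i.
dictator-certificate⇒∈ : ∀ {n} {i : Fin n} (x : Input n) {S} → IsCertificate (dictator i) x S → i ∈ S
dictator-certificate⇒∈ {i = i} x {S} cert with i ∈? S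
... | yes i∈S = i∈S
... | no  i∉S = contradiction (trans (sym (cert flipped agree)) flipped-i) (not-¬ refl)
  where
  flipped = zipWith _xor_ (∁ S) x
  ∁-lookup : ∀ j → lookup (∁ S) j ≡ not (lookup S j)
  ∁-lookup j = lookup-map j not S
  agree : AgreeOn S flipped x
  agree j j∈S = begin
    lookup flipped j                 ≡⟨ lookup-zipWith _xor_ j (∁ S) x ⟩
    lookup (∁ S) j xor lookup x j    ≡⟨ cong (_xor lookup x j) (∁-lookup j) ⟩
    not (lookup S j) xor lookup x j  ≡⟨ cong (λ b → not b xor lookup x j) ([]=⇒lookup j∈S) ⟩
    lookup x j                       ∎
    where open ≡-Reasoning
  flipped-i : lookup flipped i ≡ not (lookup x i)
  flipped-i = begin
    lookup flipped i                 ≡⟨ lookup-zipWith _xor_ i (∁ S) x ⟩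
    lookup (∁ S) i xor lookup x i    ≡⟨ cong (_xor lookup x i) (∁-lookup i) ⟩
    not (lookup S i) xor lookup x i  ≡⟨ cong (λ b → not b xor lookup x i) (∉⇒lookup≡outside i∉S) ⟩
    not (lookup x i)                 ∎
    where open ≡-Reasoning

dictator-certComplexity : ∀ {n} (i : Fin n) → CertComplexityIs (dictator i) 1
dictator-certComplexity i =
  (λ x → ⁅ i ⁆ , (λ y agree → agree i (x∈⁅x⁆ i)) , ≤-reflexive (∣⁅x⁆∣≡1 i)) ,
  ⊥ , λ S cert → ≤-<-trans z≤n (x∈p⇒∣p-x∣<∣p∣ (dictator-certificate⇒∈ ⊥ cert))

module DictatorsAtZero {n q} (ℓ : ℕ) (A : LocalAlg n q) where

  T : Tree n q
  T = tree A ⊥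

  U : Subset n
  U = ⋃ (falsePathQueries T)

  S₀ : Subset n
  S₀ = run (λ _ → false) T

  ∣U∣≤q∸1 : ∣ U ∣ ≤ q ∸ 1
  ∣U∣≤q∸1 = subst (λ m → ∣ U ∣ ≤ m + (q ∸ 1)) (∣⊥∣≡0 n) (∣⋃falsePathQueries∣≤ T (local A ⊥))

  success⇒∈U⊎∈S₀ : ∀ {i} → Success ℓ (dictator i) ⊥ A → i ∈ U ⊎ (i ∈ S₀ × ∣ S₀ ∣ ≡ ℓ)
  success⇒∈U⊎∈S₀ {i} (cert , size) with i ∈? U
  ... | yes i∈U = inj₁ i∈U
  ... | no  i∉U = inj₂ ( dictator-certificate⇒∈ ⊥ (subst (IsCertificate (dictator i) ⊥) run≡S₀ cert)
                       , trans (cong ∣_∣ (sym run≡S₀)) size )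
    where
    run≡S₀ : run (dictator i) T ≡ S₀
    run≡S₀ = run-falsePath (dictator i) T
               (All.map ∉⇒lookup≡outside (∉⋃⇒All∉ (falsePathQueries T) i∉U))

  successes-covered : ∃ λ (B : Subset n) →
    ∣ B ∣ ≤ ℓ + (q ∸ 1) × (∀ i → Success ℓ (dictator i) ⊥ A → i ∈ B)
  successes-covered with ∣ S₀ ∣ ≟ ℓ
  ... | yes ∣S₀∣≡ℓ = U ∪ S₀ , size , λ _ → [ p⊆p∪q S₀ , q⊆p∪q U S₀ ∘ proj₁ ] ∘ success⇒∈U⊎∈S₀
    where
    size : ∣ U ∪ S₀ ∣ ≤ ℓ + (q ∸ 1)
    size = begin
      ∣ U ∪ S₀ ∣          ≤⟨ ∣p∪q∣≤∣p∣+∣q∣ U S₀ ⟩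
      ∣ U ∣ + ∣ S₀ ∣      ≤⟨ +-monoˡ-≤ ∣ S₀ ∣ ∣U∣≤q∸1 ⟩
      (q ∸ 1) + ∣ S₀ ∣    ≡⟨ +-comm (q ∸ 1) ∣ S₀ ∣ ⟩
      ∣ S₀ ∣ + (q ∸ 1)    ≡⟨ cong (_+ (q ∸ 1)) ∣S₀∣≡ℓ ⟩
      ℓ + (q ∸ 1)         ∎
      where open ≤-Reasoning
  ... | no  ∣S₀∣≢ℓ = U , ≤-trans ∣U∣≤q∸1 (m≤n+m (q ∸ 1) ℓ) ,
                     λ _ → [ id , (λ (_ , ∣S₀∣≡ℓ) → contradiction ∣S₀∣≡ℓ ∣S₀∣≢ℓ) ] ∘ success⇒∈U⊎∈S₀

indicator : ∀ {n} → Subset n → Fin n → ℕ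
indicator p i = if lookup p i then 1 else 0

∈⇒indicator≡1 : ∀ {n} {p : Subset n} {i} → i ∈ p → indicator p i ≡ 1
∈⇒indicator≡1 i∈p rewrite []=⇒lookup i∈p = refl

∑-indicator : ∀ {n} (p : Subset n) → ∑[ i < n ] indicator p i ≡ ∣ p ∣
∑-indicator []            = refl
∑-indicator (inside  ∷ p) = cong suc (∑-indicator p)
∑-indicator (outside ∷ p) = ∑-indicator p

∑-mono-≤ : ∀ {n} {f g : Fin n → ℕ} → (∀ i → f i ≤ g i) → ∑[ i < n ] f i ≤ ∑[ i < n ] g i
∑-mono-≤ {zero}  _   = ≤-refl
∑-mono-≤ {suc n} f≤g = +-mono-≤ (f≤g zero) (∑-mono-≤ (f≤g ∘ suc))

∃-≤-average : ∀ n (g : Fin (suc n) → ℕ) → ∃ λ i → g i * suc n ≤ ∑[ j < suc n ] g j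
∃-≤-average zero    g = zero , ≤-reflexive (trans (*-identityʳ _) (sym (+-identityʳ _)))
∃-≤-average (suc n) g with ∃-≤-average n (g ∘ suc)
... | j , gj≤avg with g zero ≤? g (suc j)
... | yes g0≤gj = zero , ≤-trans (≤-reflexive (*-suc (g zero) (suc n)))
                           (+-monoʳ-≤ (g zero) (≤-trans (*-monoˡ-≤ (suc n) g0≤gj) gj≤avg))
... | no  g0≰gj = suc j , ≤-trans (≤-reflexive (*-suc (g (suc j)) (suc n)))
                            (+-mono-≤ (<⇒≤ (≰⇒> g0≰gj)) gj≤avg)

∑-count≤ : ∀ {n c} {X : Set} (P : Fin n → X → Set) (P? : ∀ i x → Dec (P i x)) →
  (∀ x → ∃ λ (B : Subset n) → ∣ B ∣ ≤ c × (∀ i → P i x → i ∈ B)) →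
  ∀ xs → ∑[ i < n ] length (filter (P? i) xs) ≤ c * length xs
∑-count≤ {n} {c} P P? covered [] =
  ≤-reflexive (trans (sum-replicate-zero n) (sym (*-zeroʳ c)))
∑-count≤ {n} {c} P P? covered (x ∷ xs) with covered x
... | B , ∣B∣≤c , P⇒∈B = begin
  ∑[ i < n ] length (filter (P? i) (x ∷ xs))                ≤⟨ ∑-mono-≤ count-∷ ⟩
  ∑[ i < n ] (indicator B i + length (filter (P? i) xs))    ≡⟨ ∑-distrib-+ (indicator B) _ ⟩
  ∑[ i < n ] indicator B i + ∑[ i < n ] length (filter (P? i) xs)
    ≤⟨ +-mono-≤ (≤-trans (≤-reflexive (∑-indicator B)) ∣B∣≤c) (∑-count≤ P P? covered xs) ⟩
  c + c * length xs                                         ≡⟨ *-suc c (length xs) ⟨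
  c * length (x ∷ xs)                                       ∎
  where
  open ≤-Reasoning
  count-∷ : ∀ i → length (filter (P? i) (x ∷ xs)) ≤ indicator B i + length (filter (P? i) xs)
  count-∷ i with P? i x
  ... | yes Pix = +-monoˡ-≤ _ (≤-reflexive (sym (∈⇒indicator≡1 (P⇒∈B i Pix))))
  ... | no  _   = m≤n+m _ _

claim7p2 : ∀ (n q ℓ : ℕ) → n ≥ 1 → q ≥ 1 → (𝒜 : RandLocalAlg n q) →
    Σ (BoolFun n) λ f → Monotone f × CertComplexityIs f 1 ×
      Σ (Input n) λ x⋆ → successCount ℓ f x⋆ 𝒜 * n ≤ (ℓ + q ∸ 1) * length 𝒜
claim7p2 (suc n) q ℓ (s≤s z≤n) q≥1 𝒜 with ∃-≤-average n (λ j → successCount ℓ (dictator j) ⊥ 𝒜)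
... | i , below-average = dictator i , dictator-monotone i , dictator-certComplexity i , ⊥ , bound
  where
  open ≤-Reasoning
  bound : successCount ℓ (dictator i) ⊥ 𝒜 * suc n ≤ (ℓ + q ∸ 1) * length 𝒜
  bound = begin
    successCount ℓ (dictator i) ⊥ 𝒜 * suc n                ≤⟨ below-average ⟩
    ∑[ j < suc n ] successCount ℓ (dictator j) ⊥ 𝒜
      ≤⟨ ∑-count≤ (λ j A → Success ℓ (dictator j) ⊥ A) (λ j A → success? ℓ (dictator j) ⊥ A)
                  (DictatorsAtZero.successes-covered ℓ) 𝒜 ⟩
    (ℓ + (q ∸ 1)) * length 𝒜                              ≡⟨ cong (_* length 𝒜) (+-∸-assoc ℓ q≥1) ⟨
    (ℓ + q ∸ 1) * length 𝒜                                ∎
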